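{- Let $R$ be a commutative ring with $1$, $\mathcal{A}=\{A_1,A_2,\dots\}$ an indexed set of non-commuting symbols, and for each $A_i\in\mathcal{A}$ let $F^{A_i}:U\to R$ be an $R$-valued reciprocity function. Then there exists an $R$-valued multiple reciprocity function based on $\mathcal{A}$ whose $A_i$-component is $F^{A_i}$ for every $A_i\in\mathcal{A}$.
   Context: $U=\{(p,q)\in\mathbb{Z}^2:\gcd(p,q)=1\}$. An $R$-valued reciprocity function is a map $F:U\to R$ with $F(p,-q)=F(-p,q)$, $F(p,q)+F(-q,p)=0$ and $F(p,p+q)+F(p+q,q)=F(p,q)$ for all $(p,q)\in U$ (reciprocity function for the additive group of $R$). $\mathcal{A}^*$ is the set of words in $\mathcal{A}$ (including $\emptyset$), $R\langle\langle\mathcal{A}\rangle\rangle$ the ring of non-commutative formal power series $\sum_{w\in\mathcal{A}^*}c_ww$, $R\langle\langle\mathcal{A}\rangle\rangle^\times$ its unit group. An $R$-valued multiple reciprocity function based on $\mathcal{A}$ is a map $F:U\to R\langle\langle\mathcal{A}\rangle\rangle^\times$ of the form $F(p,q)=1+\sum_{w\neq\emptyset}F^w(p,q)w$ (with $w$-component $F^w:U\to R$) satisfying $F(p,-q)=F(-p,q)$, $F(p,q)F(-q,p)=1$ and $F(p,p+q)F(p+q,q)=F(p,q)$ for all $(p,q)\in U$. -}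

module Defs where

open import Level using (Level)
open import Algebra.Bundles using (CommutativeRing)
open import Data.Nat using (ℕ)
open import Data.Integer using (ℤ; _+_; -_)
open import Data.Integer.Coprimality using (Coprime)
open import Data.List using (List; []; _∷_; map; foldr)
open import Data.Product using (_×_; _,_)

Word : Set → Set
Word A = List A

splits : {A : Set} → List A → List (List A × List A)
splits [] = ([] , []) ∷ []
splits (a ∷ w) = ([] , a ∷ w) ∷ map (λ { (u , v) → (a ∷ u , v) }) (splits w)

module PowerSeries {c ℓ : Level} (R : CommutativeRing c ℓ) (A : Set) where
  open CommutativeRing R using (_≈_; 0#; 1#) renaming (Carrier to Rc; _+_ to _+R_; _*_ to _*R_)

  Series : Set c
  Series = Word A → Rc

  _≈S_ : Series → Series → Set ℓ
  f ≈S g = ∀ w → f w ≈ g w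

  oneS : Series
  oneS [] = 1#
  oneS (_ ∷ _) = 0#

  _·S_ : Series → Series → Series
  (f ·S g) w = foldr (λ { (u , v) acc → (f u *R g v) +R acc }) 0# (splits w)

  -- U = {(p,q) ∈ ℤ² : gcd(p,q) = 1}; maps U → X are represented as
  -- functions ℤ → ℤ → X whose values are only constrained on U.

  IsReciprocity : (ℤ → ℤ → Rc) → Set ℓ
  IsReciprocity F =
    ∀ p q → Coprime p q →
      (F p (- q) ≈ F (- p) q)
      × (F p q +R F (- q) p ≈ 0#)
      × (F p (p + q) +R F (p + q) q ≈ F p q)

  -- R-valued multiple reciprocity function based on A, on U:
  -- values have constant term 1 (so lie in R⟨⟨A⟩⟩^×) and satisfy the
  -- multiplicative relations.
  IsMultipleReciprocity : (ℤ → ℤ → Series) → Set ℓ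
  IsMultipleReciprocity F =
    ∀ p q → Coprime p q →
      (F p q [] ≈ 1#)
      × (F p (- q) ≈S F (- p) q)
      × ((F p q ·S F (- q) p) ≈S oneS)
      × ((F p (p + q) ·S F (p + q) q) ≈S F p q)

{-# OPTIONS --safe #-}
module Submission where

-- Taking the coefficients of the single letters is a homomorphism from the group of series
-- with constant term 1 to the additive group of functions 𝒜 → R.  On pairs of positive
-- integers the relation F(a, a+b) F(a+b, b) = F(a, b) and the subtractive Euclidean
-- algorithm determine F from its values F(a, b) with a < b (and F(a, a) = 1); there we take
-- 1 + Σᵢ F^{Aᵢ}(a, b) Aᵢ.  Extending by F(p, -q) = F(-p, q) and F(-q, p) = F(p, q)⁻¹, all three
-- relations become group identities.  The letter coefficients then obey the additive form of
-- the same Euclidean recursion, which every reciprocity function F^{Aᵢ} also satisfies, so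
-- they agree with F^{Aᵢ} on coprime pairs.

open import Defs
open import Level using (Level; _⊔_)
open import Algebra.Bundles using (CommutativeRing; Group)
import Algebra.Properties.Group as GroupProperties
open import Data.Empty using (⊥-elim)
open import Data.Integer as ℤ using (ℤ; +0; +[1+_]; -[1+_]; _⊖_)
import Data.Integer.Properties as ℤ
open import Data.Integer.Coprimality using (Coprime)
open import Data.List using ([]; _∷_)
open import Data.List.Properties using (foldr-map)
open import Data.Nat as ℕ using (ℕ; zero; suc; _<_; _≤_; s≤s; compare; less; equal; greater)
import Data.Nat.Properties as ℕ
import Data.Nat.Coprimality as ℕ
open import Data.Nat.Divisibility using (∣-refl; ∣m∣n⇒∣m+n)
open import Data.Product using (Σ; _×_; _,_; proj₁; proj₂)
open import Function using (_∘_)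
open import Relation.Binary.Bundles using (Setoid)
import Relation.Binary.PropositionalEquality as ≡
open ≡ using (_≡_)

module PowerSeriesProperties {c ℓ : Level} (R : CommutativeRing c ℓ) (A : Set) where
  open CommutativeRing R renaming (Carrier to Rc)
  open PowerSeries R A
  open import Algebra.Solver.Ring.NaturalCoefficients.Default commutativeSemiring

  ≈S-setoid : Setoid c ℓ
  ≈S-setoid = record
    { Carrier = Series
    ; _≈_ = _≈S_
    ; isEquivalence = record
      { refl = λ _ → refl
      ; sym = λ f≈g w → sym (f≈g w)
      ; trans = λ f≈g g≈h w → trans (f≈g w) (g≈h w)
      }
    }

  open Setoid ≈S-setoid public using () renaming (refl to ≈S-refl; sym to ≈S-sym; trans to ≈S-trans)

  ∂ : A → Series → Series
  ∂ a f w = f (a ∷ w)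

  ·S-[] : ∀ f g → (f ·S g) [] ≈ f [] * g []
  ·S-[] f g = +-identityʳ _

  ·S-∷ : ∀ f g a w → (f ·S g) (a ∷ w) ≡ f [] * g (a ∷ w) + (∂ a f ·S g) w
  ·S-∷ f g a w = ≡.cong (f [] * g (a ∷ w) +_) (foldr-map _ _ 0# (splits w))

  ·S-letter : ∀ f g a → (f ·S g) (a ∷ []) ≈ f [] * g (a ∷ []) + f (a ∷ []) * g []
  ·S-letter f g a = +-congˡ (·S-[] (∂ a f) g)

  module _ where
    open import Relation.Binary.Reasoning.Setoid setoid

    ·S-cong : ∀ {f f′ g g′} → f ≈S f′ → g ≈S g′ → (f ·S g) ≈S (f′ ·S g′)
    ·S-cong {f} {f′} {g} {g′} f≈f′ g≈g′ [] = begin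
      (f ·S g) []     ≈⟨ ·S-[] f g ⟩
      f [] * g []     ≈⟨ *-cong (f≈f′ []) (g≈g′ []) ⟩
      f′ [] * g′ []   ≈⟨ ·S-[] f′ g′ ⟨
      (f′ ·S g′) []   ∎
    ·S-cong {f} {f′} {g} {g′} f≈f′ g≈g′ (a ∷ w) = begin
      (f ·S g) (a ∷ w)                         ≡⟨ ·S-∷ f g a w ⟩
      f [] * g (a ∷ w) + (∂ a f ·S g) w        ≈⟨ +-cong (*-cong (f≈f′ []) (g≈g′ (a ∷ w)))
                                                          (·S-cong (λ u → f≈f′ (a ∷ u)) g≈g′ w) ⟩
      f′ [] * g′ (a ∷ w) + (∂ a f′ ·S g′) w    ≡⟨ ·S-∷ f′ g′ a w ⟨
      (f′ ·S g′) (a ∷ w)                       ∎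

    ·S-zeroˡ : ∀ g → ((λ _ → 0#) ·S g) ≈S (λ _ → 0#)
    ·S-zeroˡ g [] = trans (·S-[] (λ _ → 0#) g) (zeroˡ _)
    ·S-zeroˡ g (a ∷ w) = begin
      ((λ _ → 0#) ·S g) (a ∷ w)                  ≡⟨ ·S-∷ (λ _ → 0#) g a w ⟩
      0# * g (a ∷ w) + ((λ _ → 0#) ·S g) w       ≈⟨ +-cong (zeroˡ _) (·S-zeroˡ g w) ⟩
      0# + 0#                                     ≈⟨ +-identityʳ 0# ⟩
      0#                                          ∎

    ·S-identityˡ : ∀ g → (oneS ·S g) ≈S g
    ·S-identityˡ g [] = trans (·S-[] oneS g) (*-identityˡ _)
    ·S-identityˡ g (a ∷ w) = begin
      (oneS ·S g) (a ∷ w)                        ≡⟨ ·S-∷ oneS g a w ⟩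
      1# * g (a ∷ w) + ((λ _ → 0#) ·S g) w       ≈⟨ +-cong (*-identityˡ _) (·S-zeroˡ g w) ⟩
      g (a ∷ w) + 0#                              ≈⟨ +-identityʳ _ ⟩
      g (a ∷ w)                                   ∎

    ·S-identityʳ : ∀ f → (f ·S oneS) ≈S f
    ·S-identityʳ f [] = trans (·S-[] f oneS) (*-identityʳ _)
    ·S-identityʳ f (a ∷ w) = begin
      (f ·S oneS) (a ∷ w)                        ≡⟨ ·S-∷ f oneS a w ⟩
      f [] * 0# + (∂ a f ·S oneS) w              ≈⟨ +-cong (zeroʳ _) (·S-identityʳ (∂ a f) w) ⟩
      0# + f (a ∷ w)                              ≈⟨ +-identityˡ _ ⟩
      f (a ∷ w)                                   ∎

    ·S-scaleˡ : ∀ k f g → ((λ u → k * f u) ·S g) ≈S (λ w → k * (f ·S g) w)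
    ·S-scaleˡ k f g [] = begin
      ((λ u → k * f u) ·S g) []                  ≈⟨ ·S-[] (λ u → k * f u) g ⟩
      k * f [] * g []                             ≈⟨ *-assoc k (f []) (g []) ⟩
      k * (f [] * g [])                           ≈⟨ *-congˡ (·S-[] f g) ⟨
      k * (f ·S g) []                             ∎
    ·S-scaleˡ k f g (a ∷ w) = begin
      ((λ u → k * f u) ·S g) (a ∷ w)             ≡⟨ ·S-∷ (λ u → k * f u) g a w ⟩
      k * f [] * g (a ∷ w) + ((λ u → k * f (a ∷ u)) ·S g) w
        ≈⟨ +-congˡ (·S-scaleˡ k (∂ a f) g w) ⟩
      k * f [] * g (a ∷ w) + k * (∂ a f ·S g) w
        ≈⟨ solve 4 (λ k x y z → k :* x :* y :+ k :* z := k :* (x :* y :+ z))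
                 refl k (f []) (g (a ∷ w)) ((∂ a f ·S g) w) ⟩
      k * (f [] * g (a ∷ w) + (∂ a f ·S g) w)    ≡⟨ ≡.cong (k *_) (·S-∷ f g a w) ⟨
      k * (f ·S g) (a ∷ w)                        ∎

    ·S-distribʳ : ∀ f f′ g → ((λ u → f u + f′ u) ·S g) ≈S (λ w → (f ·S g) w + (f′ ·S g) w)
    ·S-distribʳ f f′ g [] = begin
      ((λ u → f u + f′ u) ·S g) []               ≈⟨ ·S-[] (λ u → f u + f′ u) g ⟩
      (f [] + f′ []) * g []                       ≈⟨ distribʳ (g []) (f []) (f′ []) ⟩
      f [] * g [] + f′ [] * g []                  ≈⟨ +-cong (·S-[] f g) (·S-[] f′ g) ⟨
      (f ·S g) [] + (f′ ·S g) []                  ∎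
    ·S-distribʳ f f′ g (a ∷ w) = begin
      ((λ u → f u + f′ u) ·S g) (a ∷ w)
        ≡⟨ ·S-∷ (λ u → f u + f′ u) g a w ⟩
      (f [] + f′ []) * g (a ∷ w) + ((λ u → f (a ∷ u) + f′ (a ∷ u)) ·S g) w
        ≈⟨ +-congˡ (·S-distribʳ (∂ a f) (∂ a f′) g w) ⟩
      (f [] + f′ []) * g (a ∷ w) + ((∂ a f ·S g) w + (∂ a f′ ·S g) w)
        ≈⟨ solve 5 (λ x x′ y z z′ → (x :+ x′) :* y :+ (z :+ z′) := (x :* y :+ z) :+ (x′ :* y :+ z′))
                 refl (f []) (f′ []) (g (a ∷ w)) ((∂ a f ·S g) w) ((∂ a f′ ·S g) w) ⟩
      (f [] * g (a ∷ w) + (∂ a f ·S g) w) + (f′ [] * g (a ∷ w) + (∂ a f′ ·S g) w)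
        ≡⟨ ≡.cong₂ _+_ (·S-∷ f g a w) (·S-∷ f′ g a w) ⟨
      (f ·S g) (a ∷ w) + (f′ ·S g) (a ∷ w)
        ∎

    ·S-assoc : ∀ f g h → ((f ·S g) ·S h) ≈S (f ·S (g ·S h))
    ·S-assoc f g h [] = begin
      ((f ·S g) ·S h) []                          ≈⟨ ·S-[] (f ·S g) h ⟩
      (f ·S g) [] * h []                          ≈⟨ *-congʳ (·S-[] f g) ⟩
      f [] * g [] * h []                          ≈⟨ *-assoc (f []) (g []) (h []) ⟩
      f [] * (g [] * h [])                        ≈⟨ *-congˡ (·S-[] g h) ⟨
      f [] * (g ·S h) []                          ≈⟨ ·S-[] f (g ·S h) ⟨
      (f ·S (g ·S h)) []                          ∎
    ·S-assoc f g h (a ∷ w) = begin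
      ((f ·S g) ·S h) (a ∷ w)
        ≡⟨ ·S-∷ (f ·S g) h a w ⟩
      (f ·S g) [] * h (a ∷ w) + (∂ a (f ·S g) ·S h) w
        ≈⟨ +-cong (*-congʳ (·S-[] f g)) (·S-cong (λ u → reflexive (·S-∷ f g a u)) ≈S-refl w) ⟩
      f [] * g [] * h (a ∷ w) + ((λ u → f [] * ∂ a g u + (∂ a f ·S g) u) ·S h) w
        ≈⟨ +-congˡ (trans (·S-distribʳ _ _ h w) (+-congʳ (·S-scaleˡ (f []) (∂ a g) h w))) ⟩
      f [] * g [] * h (a ∷ w) + (f [] * (∂ a g ·S h) w + ((∂ a f ·S g) ·S h) w)
        ≈⟨ +-congˡ (+-congˡ (·S-assoc (∂ a f) g h w)) ⟩
      f [] * g [] * h (a ∷ w) + (f [] * (∂ a g ·S h) w + (∂ a f ·S (g ·S h)) w)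
        ≈⟨ solve 5 (λ x y z u v → x :* y :* z :+ (x :* u :+ v) := x :* (y :* z :+ u) :+ v)
                 refl (f []) (g []) (h (a ∷ w)) ((∂ a g ·S h) w) ((∂ a f ·S (g ·S h)) w) ⟩
      f [] * (g [] * h (a ∷ w) + (∂ a g ·S h) w) + (∂ a f ·S (g ·S h)) w
        ≡⟨ ≡.cong (λ x → f [] * x + (∂ a f ·S (g ·S h)) w) (·S-∷ g h a w) ⟨
      f [] * (g ·S h) (a ∷ w) + (∂ a f ·S (g ·S h)) w
        ≡⟨ ·S-∷ f (g ·S h) a w ⟨
      (f ·S (g ·S h)) (a ∷ w)
        ∎

  module _ where
    open import Relation.Binary.Reasoning.Setoid ≈S-setoid

    ·S-cancel-inner : ∀ {g h} f k → (g ·S h) ≈S oneS → ((f ·S g) ·S (h ·S k)) ≈S (f ·S k)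
    ·S-cancel-inner {g} {h} f k gh≈1 = begin
      (f ·S g) ·S (h ·S k)                        ≈⟨ ·S-assoc f g (h ·S k) ⟩
      f ·S (g ·S (h ·S k))                        ≈⟨ ·S-cong ≈S-refl (≈S-sym (·S-assoc g h k)) ⟩
      f ·S ((g ·S h) ·S k)                        ≈⟨ ·S-cong ≈S-refl (·S-cong gh≈1 ≈S-refl) ⟩
      f ·S (oneS ·S k)                            ≈⟨ ·S-cong ≈S-refl (·S-identityˡ k) ⟩
      f ·S k                                      ∎

  record UnitSeries : Set (c ⊔ ℓ) where
    field
      series    : Series
      inverse   : Series
      series-[] : series [] ≈ 1#
      inverseˡ  : (inverse ·S series) ≈S oneS
      inverseʳ  : (series ·S inverse) ≈S oneS

  open UnitSeries public

  module _ where
    open import Relation.Binary.Reasoning.Setoid setoid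

    inverse-[] : ∀ x → inverse x [] ≈ 1#
    inverse-[] x = begin
      inverse x []                               ≈⟨ *-identityʳ _ ⟨
      inverse x [] * 1#                          ≈⟨ *-congˡ (series-[] x) ⟨
      inverse x [] * series x []                 ≈⟨ ·S-[] (inverse x) (series x) ⟨
      (inverse x ·S series x) []                 ≈⟨ inverseˡ x [] ⟩
      1#                                         ∎

  ε : UnitSeries
  ε = record
    { series = oneS ; inverse = oneS ; series-[] = refl
    ; inverseˡ = ·S-identityˡ oneS ; inverseʳ = ·S-identityˡ oneS }

  infixl 7 _∙_
  infix  8 _⁻¹

  _∙_ : UnitSeries → UnitSeries → UnitSeries
  x ∙ y = record
    { series    = series x ·S series y
    ; inverse   = inverse y ·S inverse x
    ; series-[] = trans (·S-[] (series x) (series y))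
                    (trans (*-cong (series-[] x) (series-[] y)) (*-identityˡ 1#))
    ; inverseˡ  = ≈S-trans (·S-cancel-inner (inverse y) (series y) (inverseˡ x)) (inverseˡ y)
    ; inverseʳ  = ≈S-trans (·S-cancel-inner (series x) (inverse x) (inverseʳ y)) (inverseʳ x)
    }

  _⁻¹ : UnitSeries → UnitSeries
  x ⁻¹ = record
    { series = inverse x ; inverse = series x ; series-[] = inverse-[] x
    ; inverseˡ = inverseʳ x ; inverseʳ = inverseˡ x }

  inverse-cong : ∀ {x y} → series x ≈S series y → inverse x ≈S inverse y
  inverse-cong {x} {y} x≈y = begin
    inverse x                                    ≈⟨ ·S-identityʳ (inverse x) ⟨
    inverse x ·S oneS                            ≈⟨ ·S-cong ≈S-refl (inverseʳ y) ⟨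
    inverse x ·S (series y ·S inverse y)         ≈⟨ ·S-assoc (inverse x) (series y) (inverse y) ⟨
    (inverse x ·S series y) ·S inverse y         ≈⟨ ·S-cong (·S-cong ≈S-refl (≈S-sym x≈y)) ≈S-refl ⟩
    (inverse x ·S series x) ·S inverse y         ≈⟨ ·S-cong (inverseˡ x) ≈S-refl ⟩
    oneS ·S inverse y                            ≈⟨ ·S-identityˡ (inverse y) ⟩
    inverse y                                    ∎
    where open import Relation.Binary.Reasoning.Setoid ≈S-setoid

  -- A record rather than `_≈S_ on series`, so that the units it relates can be inferred.
  infix 4 _≈ᵘ_
  record _≈ᵘ_ (x y : UnitSeries) : Set ℓ where
    constructor series-≈
    field ≈-series : series x ≈S series y

  open _≈ᵘ_ public

  unitGroup : Group (c ⊔ ℓ) ℓ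
  unitGroup = record
    { Carrier = UnitSeries
    ; _≈_ = _≈ᵘ_
    ; _∙_ = _∙_
    ; ε = ε
    ; _⁻¹ = _⁻¹
    ; isGroup = record
      { isMonoid = record
        { isSemigroup = record
          { isMagma = record
            { isEquivalence = record
              { refl  = series-≈ ≈S-refl
              ; sym   = λ (series-≈ x≈y) → series-≈ (≈S-sym x≈y)
              ; trans = λ (series-≈ x≈y) (series-≈ y≈z) → series-≈ (≈S-trans x≈y y≈z)
              }
            ; ∙-cong = λ (series-≈ x≈y) (series-≈ u≈v) → series-≈ (·S-cong x≈y u≈v)
            }
          ; assoc = λ x y z → series-≈ (·S-assoc (series x) (series y) (series z))
          }
        ; identity = (λ x → series-≈ (·S-identityˡ (series x)))
                   , (λ x → series-≈ (·S-identityʳ (series x)))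
        }
      ; inverse = (λ x → series-≈ (inverseˡ x)) , (λ x → series-≈ (inverseʳ x))
      ; ⁻¹-cong = λ {x} {y} (series-≈ x≈y) → series-≈ (inverse-cong {x} {y} x≈y)
      }
    }

  module _ where
    open import Relation.Binary.Reasoning.Setoid setoid
    open GroupProperties +-group using (inverseʳ-unique)

    linear-∙ : ∀ x y a → series (x ∙ y) (a ∷ []) ≈ series x (a ∷ []) + series y (a ∷ [])
    linear-∙ x y a = begin
      series (x ∙ y) (a ∷ [])                                  ≈⟨ ·S-letter (series x) (series y) a ⟩
      series x [] * series y (a ∷ []) + series x (a ∷ []) * series y []
        ≈⟨ +-cong (*-congʳ (series-[] x)) (*-congˡ (series-[] y)) ⟩
      1# * series y (a ∷ []) + series x (a ∷ []) * 1#          ≈⟨ +-cong (*-identityˡ _) (*-identityʳ _) ⟩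
      series y (a ∷ []) + series x (a ∷ [])                    ≈⟨ +-comm _ _ ⟩
      series x (a ∷ []) + series y (a ∷ [])                    ∎

    linear-⁻¹ : ∀ x a → inverse x (a ∷ []) ≈ - series x (a ∷ [])
    linear-⁻¹ x a = inverseʳ-unique (series x (a ∷ [])) (inverse x (a ∷ []))
      (trans (sym (linear-∙ x (x ⁻¹) a)) (inverseʳ x (a ∷ [])))

  linearSeries : (A → Rc) → Series
  linearSeries k []          = 1#
  linearSeries k (a ∷ [])    = k a
  linearSeries k (_ ∷ _ ∷ _) = 0#

  geometricSeries : (A → Rc) → Series
  geometricSeries k []      = 1#
  geometricSeries k (a ∷ w) = - k a * geometricSeries k w

  module _ (k : A → Rc) where
    open import Relation.Binary.Reasoning.Setoid setoid
    open import Algebra.Properties.Ring ring using (-‿distribˡ-*)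

    geometric·linear : (geometricSeries k ·S linearSeries k) ≈S oneS
    geometric·linear [] = trans (·S-[] (geometricSeries k) (linearSeries k)) (*-identityˡ 1#)
    geometric·linear (a ∷ w) = begin
      (geometricSeries k ·S linearSeries k) (a ∷ w)
        ≡⟨ ·S-∷ (geometricSeries k) (linearSeries k) a w ⟩
      1# * linearSeries k (a ∷ w) + ((λ u → - k a * geometricSeries k u) ·S linearSeries k) w
        ≈⟨ +-cong (*-identityˡ _) (·S-scaleˡ (- k a) (geometricSeries k) (linearSeries k) w) ⟩
      linearSeries k (a ∷ w) + - k a * (geometricSeries k ·S linearSeries k) w
        ≈⟨ +-congˡ (*-congˡ (geometric·linear w)) ⟩
      linearSeries k (a ∷ w) + - k a * oneS w
        ≈⟨ cancel w ⟩
      0#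
        ∎
      where
      cancel : ∀ w → linearSeries k (a ∷ w) + - k a * oneS w ≈ 0#
      cancel []      = trans (+-congˡ (*-identityʳ _)) (-‿inverseʳ (k a))
      cancel (_ ∷ _) = trans (+-congˡ (zeroʳ _)) (+-identityʳ 0#)

    ∂-linearSeries : ∀ a → ∂ a (linearSeries k) ≈S (λ w → k a * oneS w)
    ∂-linearSeries a []      = sym (*-identityʳ (k a))
    ∂-linearSeries a (_ ∷ _) = sym (zeroʳ (k a))

    linear·geometric : (linearSeries k ·S geometricSeries k) ≈S oneS
    linear·geometric [] = trans (·S-[] (linearSeries k) (geometricSeries k)) (*-identityˡ 1#)
    linear·geometric (a ∷ w) = begin
      (linearSeries k ·S geometricSeries k) (a ∷ w)
        ≡⟨ ·S-∷ (linearSeries k) (geometricSeries k) a w ⟩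
      1# * (- k a * geometricSeries k w) + (∂ a (linearSeries k) ·S geometricSeries k) w
        ≈⟨ +-cong (*-identityˡ _) (·S-cong (∂-linearSeries a) ≈S-refl w) ⟩
      - k a * geometricSeries k w + ((λ u → k a * oneS u) ·S geometricSeries k) w
        ≈⟨ +-congˡ (trans (·S-scaleˡ (k a) oneS (geometricSeries k) w)
                          (*-congˡ (·S-identityˡ (geometricSeries k) w))) ⟩
      - k a * geometricSeries k w + k a * geometricSeries k w
        ≈⟨ +-congʳ (-‿distribˡ-* (k a) (geometricSeries k w)) ⟨
      - (k a * geometricSeries k w) + k a * geometricSeries k w
        ≈⟨ -‿inverseˡ _ ⟩
      0#
        ∎

    linearUnit : UnitSeries
    linearUnit = record
      { series = linearSeries k ; inverse = geometricSeries k ; series-[] = refl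
      ; inverseˡ = geometric·linear ; inverseʳ = linear·geometric }

module _ {g₁ g₂} (G : Group g₁ g₂) where
  open Group G
  open GroupProperties G using (inverseˡ-unique; inverseʳ-unique)
  open import Relation.Binary.Reasoning.Setoid setoid

  x∙y≈z⇒z⁻¹∙x≈y⁻¹ : ∀ {x y z} → x ∙ y ≈ z → z ⁻¹ ∙ x ≈ y ⁻¹
  x∙y≈z⇒z⁻¹∙x≈y⁻¹ {x} {y} {z} x∙y≈z = inverseˡ-unique (z ⁻¹ ∙ x) y (begin
    z ⁻¹ ∙ x ∙ y      ≈⟨ assoc (z ⁻¹) x y ⟩
    z ⁻¹ ∙ (x ∙ y)    ≈⟨ ∙-congˡ x∙y≈z ⟩
    z ⁻¹ ∙ z          ≈⟨ inverseˡ z ⟩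
    ε                 ∎)

  x∙y≈z⇒y∙z⁻¹≈x⁻¹ : ∀ {x y z} → x ∙ y ≈ z → y ∙ z ⁻¹ ≈ x ⁻¹
  x∙y≈z⇒y∙z⁻¹≈x⁻¹ {x} {y} {z} x∙y≈z = inverseʳ-unique x (y ∙ z ⁻¹) (begin
    x ∙ (y ∙ z ⁻¹)    ≈⟨ assoc x y (z ⁻¹) ⟨
    x ∙ y ∙ z ⁻¹      ≈⟨ ∙-congʳ x∙y≈z ⟩
    z ∙ z ⁻¹          ≈⟨ inverseʳ z ⟩
    ε                 ∎)

compare-refl : ∀ a → compare a a ≡ equal a
compare-refl zero = ≡.refl
compare-refl (suc a) rewrite compare-refl a = ≡.refl

compare-less : ∀ a k → compare a (suc (a ℕ.+ k)) ≡ less a k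
compare-less zero    k = ≡.refl
compare-less (suc a) k rewrite compare-less a k = ≡.refl

compare-greater : ∀ b k → compare (suc (b ℕ.+ k)) b ≡ greater b k
compare-greater zero    k = ≡.refl
compare-greater (suc b) k rewrite compare-greater b k = ≡.refl

m⊖[1+m+k]≡-[1+k] : ∀ m k → m ⊖ suc (m ℕ.+ k) ≡ -[1+ k ]
m⊖[1+m+k]≡-[1+k] m k = ≡.trans
  (≡.cong₂ _⊖_ (≡.sym (ℕ.+-identityʳ m)) (≡.sym (ℕ.+-suc m k))) (ℤ.+-cancelˡ-⊖ m 0 (suc k))

[1+m+k]⊖m≡+[1+k] : ∀ m k → suc (m ℕ.+ k) ⊖ m ≡ +[1+ k ]
[1+m+k]⊖m≡+[1+k] m k = ≡.trans
  (≡.cong₂ _⊖_ (≡.sym (ℕ.+-suc m k)) (≡.sym (ℕ.+-identityʳ m))) (ℤ.+-cancelˡ-⊖ m (suc k) 0)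

coprime-+⁻¹ : ∀ {m n} → ℕ.Coprime (n ℕ.+ m) n → ℕ.Coprime m n
coprime-+⁻¹ coprime (d∣m , d∣n) = coprime (∣m∣n⇒∣m+n d∣n d∣m , d∣n)

[2+n+k]≤f⇒[1+k]<f : ∀ {n k f} → suc (suc n ℕ.+ k) ≤ f → suc k < f
[2+n+k]≤f⇒[1+k]<f {n} {k} = ℕ.≤-trans (s≤s (s≤s (ℕ.m≤n+m k n)))

module _ {c ℓ : Level} (R : CommutativeRing c ℓ) (A : Set) where
  open CommutativeRing R using (Carrier)
  open PowerSeries R A using (IsReciprocity)

  module ReciprocityProperties {f : ℤ → ℤ → Carrier} (f-rec : IsReciprocity f) where
    open CommutativeRing R hiding (Carrier)
    open GroupProperties +-group using (identityˡ-unique; inverseʳ-unique; y≈x\\z)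

    reciprocity-neg : ∀ p q → Coprime p q → f p (ℤ.- q) ≈ f (ℤ.- p) q
    reciprocity-neg p q cop = proj₁ (f-rec p q cop)

    reciprocity-swap : ∀ p q → Coprime p q → f (ℤ.- q) p ≈ - f p q
    reciprocity-swap p q cop = inverseʳ-unique (f p q) (f (ℤ.- q) p) (proj₁ (proj₂ (f-rec p q cop)))

    reciprocity-ℕ : ∀ a b {s} → a ℕ.+ b ≡ s → ℕ.Coprime a b →
      f (ℤ.+ s) (ℤ.+ b) ≈ - f (ℤ.+ a) (ℤ.+ s) + f (ℤ.+ a) (ℤ.+ b)
    reciprocity-ℕ a b ≡.refl cop = y≈x\\z _ _ _ (proj₂ (proj₂ (f-rec (ℤ.+ a) (ℤ.+ b) cop)))

    reciprocity-[1,1] : f (ℤ.+ 1) (ℤ.+ 1) ≈ 0#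
    reciprocity-[1,1] = identityˡ-unique _ _ (proj₂ (proj₂ (f-rec (ℤ.+ 1) (ℤ.+ 0) (ℕ.1-coprimeTo 0))))

  module Construction (F : A → ℤ → ℤ → Carrier) (F-rec : ∀ a → IsReciprocity (F a)) where
    open PowerSeriesProperties R A
    open ReciprocityProperties

    L : ℕ → ℕ → UnitSeries
    L a b = linearUnit (λ i → F i (ℤ.+ a) (ℤ.+ b))

    -- For a > b, F(a - b, a) F(a, b) = F(a - b, b) gives F(a, b); the first argument shrinks,
    -- so fuel larger than it suffices.
    euclid : ℕ → ℕ → ℕ → UnitSeries
    euclid zero    _ _ = ε
    euclid (suc f) a b with compare a b
    ... | less a k    = L a (suc (a ℕ.+ k))
    ... | equal _     = ε
    ... | greater b k = L (suc k) (suc (b ℕ.+ k)) ⁻¹ ∙ euclid f (suc k) b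

    F⁺ : ℕ → ℕ → UnitSeries
    F⁺ a b = euclid (suc a) a b

    euclid-fuel-independent : ∀ {f f′} a n → a < f → a < f′ → euclid f a (suc n) ≡ euclid f′ a (suc n)
    euclid-fuel-independent {suc f} {suc f′} a n (s≤s a≤f) (s≤s a≤f′) with compare a (suc n)
    ... | less _ _    = ≡.refl
    ... | equal _     = ≡.refl
    ... | greater _ k = ≡.cong (_ ∙_)
      (euclid-fuel-independent (suc k) n ([2+n+k]≤f⇒[1+k]<f a≤f) ([2+n+k]≤f⇒[1+k]<f a≤f′))

    F⁺-diag : ∀ a → F⁺ a a ≡ ε
    F⁺-diag a rewrite compare-refl a = ≡.refl

    F⁺-less : ∀ a k → F⁺ a (suc (a ℕ.+ k)) ≡ L a (suc (a ℕ.+ k))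
    F⁺-less a k rewrite compare-less a k = ≡.refl

    F⁺-greater : ∀ n k {s} → suc (suc n ℕ.+ k) ≡ s →
      F⁺ s (suc n) ≡ L (suc k) s ⁻¹ ∙ F⁺ (suc k) (suc n)
    F⁺-greater n k ≡.refl rewrite compare-greater (suc n) k =
      ≡.cong (_ ∙_) (euclid-fuel-independent (suc k) n (s≤s (s≤s (ℕ.m≤n+m k n))) (ℕ.n<1+n (suc k)))

    C : UnitSeries
    C = L 1 0

    -- On the axes, inversion and F(p, -q) = F(-p, q) force F(0, ±1) = F(1, 0)⁻¹.
    Fᵐ : ℤ → ℤ → UnitSeries
    Fᵐ +0       +0       = ε
    Fᵐ +0       +[1+ _ ] = C ⁻¹
    Fᵐ +0       -[1+ _ ] = C ⁻¹
    Fᵐ +[1+ _ ] +0       = C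
    Fᵐ -[1+ _ ] +0       = C
    Fᵐ +[1+ m ] +[1+ n ] = F⁺ (suc m) (suc n)
    Fᵐ -[1+ m ] -[1+ n ] = F⁺ (suc m) (suc n)
    Fᵐ +[1+ m ] -[1+ n ] = F⁺ (suc n) (suc m) ⁻¹
    Fᵐ -[1+ m ] +[1+ n ] = F⁺ (suc n) (suc m) ⁻¹

    module _ where
      open CommutativeRing R hiding (Carrier)
      open import Relation.Binary.Reasoning.Setoid setoid

      linear-euclid : ∀ {f} a n → a < f → ℕ.Coprime a (suc n) → ∀ i →
        series (euclid f a (suc n)) (i ∷ []) ≈ F i (ℤ.+ a) (ℤ.+ suc n)
      linear-euclid {suc f} a n (s≤s a≤f) cop i with compare a (suc n)
      ... | less _ _ = refl
      ... | equal _ with cop (∣-refl , ∣-refl)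
      ...   | ≡.refl = sym (reciprocity-[1,1] (F-rec i))
      linear-euclid {suc f} a n (s≤s a≤f) cop i | greater _ k = begin
        series (L (suc k) s ⁻¹ ∙ euclid f (suc k) (suc n)) (i ∷ [])
          ≈⟨ linear-∙ (L (suc k) s ⁻¹) (euclid f (suc k) (suc n)) i ⟩
        inverse (L (suc k) s) (i ∷ []) + series (euclid f (suc k) (suc n)) (i ∷ [])
          ≈⟨ +-cong (linear-⁻¹ (L (suc k) s) i)
                    (linear-euclid (suc k) n ([2+n+k]≤f⇒[1+k]<f a≤f) cop′ i) ⟩
        - F i (ℤ.+ suc k) (ℤ.+ s) + F i (ℤ.+ suc k) (ℤ.+ suc n)
          ≈⟨ reciprocity-ℕ (F-rec i) (suc k) (suc n) (≡.cong suc (ℕ.+-comm k (suc n))) cop′ ⟨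
        F i (ℤ.+ s) (ℤ.+ suc n)
          ∎
        where
        s = suc (suc n ℕ.+ k)
        cop′ : ℕ.Coprime (suc k) (suc n)
        cop′ = coprime-+⁻¹ (≡.subst (λ x → ℕ.Coprime x (suc n)) (≡.sym (≡.cong suc (ℕ.+-suc n k))) cop)

      linear-F⁺ : ∀ a n → ℕ.Coprime a (suc n) → ∀ i → series (F⁺ a (suc n)) (i ∷ []) ≈ F i (ℤ.+ a) (ℤ.+ suc n)
      linear-F⁺ a n = linear-euclid a n (ℕ.n<1+n a)

      linear-C⁻¹ : ∀ i → series (C ⁻¹) (i ∷ []) ≈ F i +0 (ℤ.+ 1)
      linear-C⁻¹ i = trans (linear-⁻¹ C i) (sym (reciprocity-swap (F-rec i) (ℤ.+ 1) +0 (ℕ.1-coprimeTo 0)))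

      linear-F⁺⁻¹ : ∀ m n → ℕ.Coprime (suc m) (suc n) → ∀ i →
        series (F⁺ (suc n) (suc m) ⁻¹) (i ∷ []) ≈ F i -[1+ m ] +[1+ n ]
      linear-F⁺⁻¹ m n cop i = begin
        series (F⁺ (suc n) (suc m) ⁻¹) (i ∷ [])     ≈⟨ linear-⁻¹ (F⁺ (suc n) (suc m)) i ⟩
        - series (F⁺ (suc n) (suc m)) (i ∷ [])      ≈⟨ -‿cong (linear-F⁺ (suc n) m (ℕ.sym cop) i) ⟩
        - F i +[1+ n ] +[1+ m ]                     ≈⟨ reciprocity-swap (F-rec i) +[1+ n ] +[1+ m ] (ℕ.sym cop) ⟨
        F i -[1+ m ] +[1+ n ]                       ∎

      linear-Fᵐ : ∀ i p q → Coprime p q → series (Fᵐ p q) (i ∷ []) ≈ F i p q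
      linear-Fᵐ i +0 +0 cop = ⊥-elim (ℕ.0≢1+n (ℕ.0-coprimeTo-m⇒m≡1 cop))
      linear-Fᵐ i +0 +[1+ n ] cop with ℕ.0-coprimeTo-m⇒m≡1 cop
      ... | ≡.refl = linear-C⁻¹ i
      linear-Fᵐ i +0 -[1+ n ] cop with ℕ.0-coprimeTo-m⇒m≡1 cop
      ... | ≡.refl = trans (linear-C⁻¹ i) (sym (reciprocity-neg (F-rec i) +0 (ℤ.+ 1) cop))
      linear-Fᵐ i +[1+ m ] +0 cop with ℕ.0-coprimeTo-m⇒m≡1 (ℕ.sym cop)
      ... | ≡.refl = refl
      linear-Fᵐ i -[1+ m ] +0 cop with ℕ.0-coprimeTo-m⇒m≡1 (ℕ.sym cop)
      ... | ≡.refl = reciprocity-neg (F-rec i) (ℤ.+ 1) +0 cop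
      linear-Fᵐ i +[1+ m ] +[1+ n ] cop = linear-F⁺ (suc m) n cop i
      linear-Fᵐ i -[1+ m ] -[1+ n ] cop =
        trans (linear-F⁺ (suc m) n cop i) (reciprocity-neg (F-rec i) +[1+ m ] -[1+ n ] cop)
      linear-Fᵐ i +[1+ m ] -[1+ n ] cop =
        trans (linear-F⁺⁻¹ m n cop i) (sym (reciprocity-neg (F-rec i) +[1+ m ] +[1+ n ] cop))
      linear-Fᵐ i -[1+ m ] +[1+ n ] cop = linear-F⁺⁻¹ m n cop i

    module _ where
      open Group unitGroup using (_≈_; refl; trans; reflexive; ∙-congˡ; ∙-congʳ; identityˡ; identityʳ)
        renaming (inverseʳ to ∙-inverseʳ)
      open GroupProperties unitGroup using (ε⁻¹≈ε; \\-leftDividesˡ)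
      open import Relation.Binary.Reasoning.Setoid (Group.setoid unitGroup)

      F⁺-recurrence : ∀ m n {s} → suc (suc (m ℕ.+ n)) ≡ s →
        F⁺ (suc m) s ∙ F⁺ s (suc n) ≈ F⁺ (suc m) (suc n)
      F⁺-recurrence m n ≡.refl = begin
        F⁺ (suc m) s ∙ F⁺ s (suc n)
          ≡⟨ ≡.cong₂ _∙_ (F⁺-less (suc m) n) (F⁺-greater n m (≡.cong (suc ∘ suc) (ℕ.+-comm n m))) ⟩
        L (suc m) s ∙ (L (suc m) s ⁻¹ ∙ F⁺ (suc m) (suc n))
          ≈⟨ \\-leftDividesˡ (L (suc m) s) (F⁺ (suc m) (suc n)) ⟩
        F⁺ (suc m) (suc n)
          ∎
        where s = suc (suc (m ℕ.+ n))

      Fᵐ-neg : ∀ p q → Fᵐ p (ℤ.- q) ≈ Fᵐ (ℤ.- p) q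
      Fᵐ-neg +0       +0       = refl
      Fᵐ-neg +0       +[1+ _ ] = refl
      Fᵐ-neg +0       -[1+ _ ] = refl
      Fᵐ-neg +[1+ _ ] +0       = refl
      Fᵐ-neg -[1+ _ ] +0       = refl
      Fᵐ-neg +[1+ _ ] +[1+ _ ] = refl
      Fᵐ-neg -[1+ _ ] -[1+ _ ] = refl
      Fᵐ-neg +[1+ _ ] -[1+ _ ] = refl
      Fᵐ-neg -[1+ _ ] +[1+ _ ] = refl

      Fᵐ-swap : ∀ p q → Fᵐ (ℤ.- q) p ≈ Fᵐ p q ⁻¹
      Fᵐ-swap +0       +0       = series-≈ ≈S-refl
      Fᵐ-swap +0       +[1+ _ ] = series-≈ ≈S-refl
      Fᵐ-swap +0       -[1+ _ ] = series-≈ ≈S-refl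
      Fᵐ-swap +[1+ _ ] +0       = series-≈ ≈S-refl
      Fᵐ-swap -[1+ _ ] +0       = series-≈ ≈S-refl
      Fᵐ-swap +[1+ _ ] +[1+ _ ] = series-≈ ≈S-refl
      Fᵐ-swap -[1+ _ ] -[1+ _ ] = series-≈ ≈S-refl
      Fᵐ-swap +[1+ _ ] -[1+ _ ] = series-≈ ≈S-refl
      Fᵐ-swap -[1+ _ ] +[1+ _ ] = series-≈ ≈S-refl

      Fᵐ-inverse : ∀ p q → Fᵐ p q ∙ Fᵐ (ℤ.- q) p ≈ ε
      Fᵐ-inverse p q = trans (∙-congˡ (Fᵐ-swap p q)) (∙-inverseʳ (Fᵐ p q))

      Fᵐ-diag : ∀ p → Fᵐ p p ≈ ε
      Fᵐ-diag +0       = refl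
      Fᵐ-diag +[1+ m ] = reflexive (F⁺-diag (suc m))
      Fᵐ-diag -[1+ m ] = reflexive (F⁺-diag (suc m))

      C∙C⁻¹≈F⁺-diag⁻¹ : ∀ a → C ∙ C ⁻¹ ≈ F⁺ a a ⁻¹
      C∙C⁻¹≈F⁺-diag⁻¹ a = begin
        C ∙ C ⁻¹     ≈⟨ ∙-inverseʳ C ⟩
        ε            ≈⟨ ε⁻¹≈ε ⟨
        ε ⁻¹         ≡⟨ ≡.cong _⁻¹ (F⁺-diag a) ⟨
        F⁺ a a ⁻¹    ∎

      Recurrence : ℤ → ℤ → Set ℓ
      Recurrence p q = Fᵐ p (p ℤ.+ q) ∙ Fᵐ (p ℤ.+ q) q ≈ Fᵐ p q

      Fᵐ-recurrence-⁺⁻ : ∀ {m n} → ℕ.Ordering m n → Recurrence +[1+ m ] -[1+ n ]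
      Fᵐ-recurrence-⁺⁻ (less m k) rewrite m⊖[1+m+k]≡-[1+k] (suc m) k =
        x∙y≈z⇒z⁻¹∙x≈y⁻¹ unitGroup (F⁺-recurrence k m (≡.cong (suc ∘ suc) (ℕ.+-comm k m)))
      Fᵐ-recurrence-⁺⁻ (equal m) rewrite ℤ.n⊖n≡0 (suc m) = C∙C⁻¹≈F⁺-diag⁻¹ (suc m)
      Fᵐ-recurrence-⁺⁻ (greater n k) rewrite [1+m+k]⊖m≡+[1+k] (suc n) k =
        x∙y≈z⇒y∙z⁻¹≈x⁻¹ unitGroup (F⁺-recurrence n k ≡.refl)

      Fᵐ-recurrence-⁻⁺ : ∀ {m n} → ℕ.Ordering n m → Recurrence -[1+ m ] +[1+ n ]
      Fᵐ-recurrence-⁻⁺ (less n k) rewrite m⊖[1+m+k]≡-[1+k] (suc n) k =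
        x∙y≈z⇒y∙z⁻¹≈x⁻¹ unitGroup (F⁺-recurrence n k ≡.refl)
      Fᵐ-recurrence-⁻⁺ (equal n) rewrite ℤ.n⊖n≡0 (suc n) = C∙C⁻¹≈F⁺-diag⁻¹ (suc n)
      Fᵐ-recurrence-⁻⁺ (greater m k) rewrite [1+m+k]⊖m≡+[1+k] (suc m) k =
        x∙y≈z⇒z⁻¹∙x≈y⁻¹ unitGroup (F⁺-recurrence k m (≡.cong (suc ∘ suc) (ℕ.+-comm k m)))

      Fᵐ-recurrence : ∀ p q → Recurrence p q
      Fᵐ-recurrence p +0 rewrite ℤ.+-identityʳ p = trans (∙-congʳ (Fᵐ-diag p)) (identityˡ (Fᵐ p +0))
      Fᵐ-recurrence +0 q rewrite ℤ.+-identityˡ q = trans (∙-congˡ (Fᵐ-diag q)) (identityʳ (Fᵐ +0 q))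
      Fᵐ-recurrence +[1+ m ] +[1+ n ] = F⁺-recurrence m n (≡.cong suc (≡.sym (ℕ.+-suc m n)))
      Fᵐ-recurrence -[1+ m ] -[1+ n ] = F⁺-recurrence m n ≡.refl
      Fᵐ-recurrence +[1+ m ] -[1+ n ] = Fᵐ-recurrence-⁺⁻ (compare m n)
      Fᵐ-recurrence -[1+ m ] +[1+ n ] = Fᵐ-recurrence-⁻⁺ (compare n m)

proposition4p5 : {c ℓ : Level} (R : CommutativeRing c ℓ) →
    (Fcomp : ℕ → ℤ → ℤ → CommutativeRing.Carrier R) →
    ((i : ℕ) → PowerSeries.IsReciprocity R ℕ (Fcomp i)) →
    Σ (ℤ → ℤ → PowerSeries.Series R ℕ) (λ F →
      PowerSeries.IsMultipleReciprocity R ℕ F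
      × ((i : ℕ) (p q : ℤ) → Coprime p q →
          CommutativeRing._≈_ R (F p q (i ∷ [])) (Fcomp i p q)))
proposition4p5 R Fcomp Fcomp-rec =
  (λ p q → series (Fᵐ p q)) ,
  (λ p q _ → series-[] (Fᵐ p q)
           , ≈-series (Fᵐ-neg p q)
           , ≈-series (Fᵐ-inverse p q)
           , ≈-series (Fᵐ-recurrence p q)) ,
  linear-Fᵐ
  where
  open PowerSeriesProperties R ℕ
  open Construction R ℕ Fcomp Fcomp-rec
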